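{- Let $d, w \in \mathbb{N}$ with $d > 1$ and $0 \leq w < 2^{d-1}$. Let $s$ and $t = (t_0,\dotsc,t_{m-1})$ ($m\ge1$) be tuples of Boolean input variables with arrival times in $\mathbb{N}$ such that $W(s) = w$ and \[ W(t) \leq 1.9 \cdot \frac{2^{d-1} - w}{d \log_2 (d)} + \frac{d-1}{d} \Lambda_t. \] Then \[ W(t) + w \leq \begin{cases} 2^{d-1} & \text{if } d \geq 2^{1.9}, \\ \dfrac{2^d}{\log_2(d)} & \text{otherwise.} \end{cases} \]
   Context: Each input variable $x$ has an arrival time $a(x) \in \mathbb{N}$ and weight $W(x) = 2^{a(x)}$; the weight of a tuple of inputs is the sum of the weights of its entries (empty tuple: $0$). For $t = (t_0,\dotsc,t_{m-1})$, $\Lambda_t := W(t_0)$ if $m = 1$ and $\Lambda_t := W(t_{m-2}) + W(t_{m-1})$ if $m > 1$. -}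

module Defs where

open import Data.Nat using (ℕ; zero; suc; _+_; _*_; _^_; _≤_)
open import Data.List using (List; []; _∷_)

-- An input variable is represented by its arrival time a(x) ∈ ℕ;
-- a tuple of inputs is a list of arrival times.

W : List ℕ → ℕ
W []       = 0
W (a ∷ as) = 2 ^ a + W as

-- Λ_t = W(t_0) if m = 1, W(t_{m-2}) + W(t_{m-1}) if m > 1
-- (value on the empty list is irrelevant; t is required to be nonempty).
Λ : List ℕ → ℕ
Λ []               = 0
Λ (a ∷ [])         = 2 ^ a
Λ (a ∷ b ∷ [])     = 2 ^ a + 2 ^ b
Λ (a ∷ b ∷ c ∷ cs) = Λ (b ∷ c ∷ cs)

-- For naturals x, d ≥ 1, c and q ≥ 1,
--   x · log₂ d ≤ c / q   ⟺   q·x·log₂ d ≤ c   ⟺   d ^ (q·x) ≤ 2 ^ c,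
-- since 2^(q·x·log₂ d) = d^(q·x) and 2^_ is strictly monotone.
-- `MulLog₂≤ x d c q` encodes the real inequality  x · log₂ d ≤ c / q  exactly.
MulLog₂≤ : ℕ → ℕ → ℕ → ℕ → Set
MulLog₂≤ x d c q = d ^ (q * x) ≤ 2 ^ c

{-# OPTIONS --safe #-}
module Submission where

-- Since Λ_t ≤ W(t), the hypothesis gives W(t)·log₂ d ≤ 1.9·(2^{d-1} − w).
-- Hence for every p ≤ 19 with p ≤ 10·log₂ d we get p·(W(t) + w) ≤ 19·2^{d-1};
-- p ≤ 19 is what lets the term p·w be absorbed into 19·w.
-- Taking p = 19 gives the first case.  Otherwise d ∈ {2, 3}, and p = 10 resp.
-- p = 15 (as 2^15 ≤ 3^10) gives W(t) + w ≤ 4 resp. 5, enough since 3^5 ≤ 2^8.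

open import Defs
open import Data.Nat using (ℕ; _+_; _*_; _∸_; _^_; _≤_; _<_)
open import Data.List using (List; length)
open import Relation.Nullary using (¬_)
open import Relation.Binary.PropositionalEquality using (_≡_)
open import Data.Product using (_×_)

open import Data.Nat using (suc; z≤n; s≤s; s≤s⁻¹)
open import Data.Nat.Properties
open import Data.List using ([]; _∷_)
open import Data.Product using (_,_)
open import Data.Unit using (tt)
open import Relation.Binary.PropositionalEquality using (cong)

Λ≤W : ∀ t → Λ t ≤ W t
Λ≤W []               = z≤n
Λ≤W (a ∷ [])         = m≤m+n (2 ^ a) 0
Λ≤W (a ∷ b ∷ [])     = +-monoʳ-≤ (2 ^ a) (m≤m+n (2 ^ b) 0)
Λ≤W (a ∷ b ∷ c ∷ cs) = m≤n⇒m≤o+n (2 ^ a) (Λ≤W (b ∷ c ∷ cs))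

W≤[1+e]W∸eΛ : ∀ e t → W t ≤ suc e * W t ∸ e * Λ t
W≤[1+e]W∸eΛ e t = m+n≤o⇒m≤o∸n (W t) (+-monoʳ-≤ (W t) (*-monoʳ-≤ e (Λ≤W t)))

^-cancelʳ-≤ : ∀ m {a b} → 1 < m → m ^ a ≤ m ^ b → a ≤ b
^-cancelʳ-≤ m 1<m mᵃ≤mᵇ = ≮⇒≥ (λ b<a → <⇒≱ (^-monoʳ-< m 1<m b<a) mᵃ≤mᵇ)

2^p≤d^q∧d^[q*x]≤2^c⇒p*x≤c : ∀ p q d x c →
  2 ^ p ≤ d ^ q → d ^ (q * x) ≤ 2 ^ c → p * x ≤ c
2^p≤d^q∧d^[q*x]≤2^c⇒p*x≤c p q d x c 2^p≤d^q d^qx≤2^c =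
  ^-cancelʳ-≤ 2 (s≤s (s≤s z≤n)) (begin
    2 ^ (p * x)  ≡⟨ ^-*-assoc 2 p x ⟨
    (2 ^ p) ^ x  ≤⟨ ^-monoˡ-≤ x 2^p≤d^q ⟩
    (d ^ q) ^ x  ≡⟨ ^-*-assoc d q x ⟩
    d ^ (q * x)  ≤⟨ d^qx≤2^c ⟩
    2 ^ c        ∎)
  where open ≤-Reasoning

p*x≤c*[n∸w]⇒p*[x+w]≤c*n : ∀ p c n x w →
  p ≤ c → w ≤ n → p * x ≤ c * (n ∸ w) → p * (x + w) ≤ c * n
p*x≤c*[n∸w]⇒p*[x+w]≤c*n p c n x w p≤c w≤n px≤c[n∸w] = begin
  p * (x + w)          ≡⟨ *-distribˡ-+ p x w ⟩
  p * x + p * w        ≤⟨ +-mono-≤ px≤c[n∸w] (*-monoˡ-≤ w p≤c) ⟩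
  c * (n ∸ w) + c * w  ≡⟨ *-distribˡ-+ c (n ∸ w) w ⟨
  c * (n ∸ w + w)      ≡⟨ cong (c *_) (m∸n+n≡m w≤n) ⟩
  c * n                ∎
  where open ≤-Reasoning

¬2^19≤d^10⇒d≤3 : ∀ d → ¬ (2 ^ 19 ≤ d ^ 10) → d ≤ 3
¬2^19≤d^10⇒d≤3 d small =
  ≮⇒≥ (λ 3<d → small (≤-trans (≤ᵇ⇒≤ (2 ^ 19) (4 ^ 10) tt) (^-monoˡ-≤ 10 3<d)))

p*x≤n<p*[1+k]⇒x≤k : ∀ p x n k → p * x ≤ n → n < p * suc k → x ≤ k
p*x≤n<p*[1+k]⇒x≤k p x n k px≤n n<p[1+k] =
  s≤s⁻¹ (*-cancelˡ-< p x (suc k) (≤-<-trans px≤n n<p[1+k]))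

small-base-bound : ∀ d x → 2 ≤ d → d ≤ 3 →
  (∀ p → p ≤ 19 → 2 ^ p ≤ d ^ 10 → p * x ≤ 19 * 2 ^ (d ∸ 1)) →
  d ^ x ≤ 2 ^ (2 ^ d)
small-base-bound 1 _ (s≤s ()) _ _
small-base-bound 2 x _ _ budget = ^-monoʳ-≤ 2 x≤4
  where
  x≤4 : x ≤ 4
  x≤4 = p*x≤n<p*[1+k]⇒x≤k 10 x 38 4 (budget 10 (≤ᵇ⇒≤ 10 19 tt) ≤-refl) (≤ᵇ⇒≤ 39 50 tt)
small-base-bound 3 x _ _ budget = ≤-trans (^-monoʳ-≤ 3 x≤5) (≤ᵇ⇒≤ (3 ^ 5) (2 ^ 8) tt)
  where
  x≤5 : x ≤ 5
  x≤5 = p*x≤n<p*[1+k]⇒x≤k 15 x 76 5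
          (budget 15 (≤ᵇ⇒≤ 15 19 tt) (≤ᵇ⇒≤ (2 ^ 15) (3 ^ 10) tt)) (≤ᵇ⇒≤ 77 90 tt)
small-base-bound (suc (suc (suc (suc _)))) _ _ (s≤s (s≤s (s≤s ()))) _

lemma3p8 : (d w : ℕ) → 1 < d → w < 2 ^ (d ∸ 1) →
    (s t : List ℕ) → 1 ≤ length t → W s ≡ w →
    -- d·W(t) ≤ 1.9·(2^{d-1} - w)/log₂ d + (d-1)·Λ_t, i.e.
    -- (d·W(t) - (d-1)·Λ_t)⁺ · log₂ d ≤ 19·(2^{d-1} - w) / 10
    MulLog₂≤ (d * W t ∸ (d ∸ 1) * Λ t) d (19 * (2 ^ (d ∸ 1) ∸ w)) 10 →
    -- d ≥ 2^{1.9}  ⟺  2^19 ≤ d^10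
    (2 ^ 19 ≤ d ^ 10 → W t + w ≤ 2 ^ (d ∸ 1)) ×
    -- otherwise  W(t) + w ≤ 2^d / log₂ d  ⟺  (W(t)+w)·log₂ d ≤ 2^d / 1
    (¬ (2 ^ 19 ≤ d ^ 10) → MulLog₂≤ (W t + w) d (2 ^ d) 1)
lemma3p8 d@(suc e) w 1<d w<2^e _ t _ _ hyp = large , small
  where
  d^[10*Wt]≤2^[19*[2^e∸w]] : d ^ (10 * W t) ≤ 2 ^ (19 * (2 ^ e ∸ w))
  d^[10*Wt]≤2^[19*[2^e∸w]] = ≤-trans (^-monoʳ-≤ d (*-monoʳ-≤ 10 (W≤[1+e]W∸eΛ e t))) hyp

  budget : ∀ p → p ≤ 19 → 2 ^ p ≤ d ^ 10 → p * (W t + w) ≤ 19 * 2 ^ e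
  budget p p≤19 2^p≤d^10 = p*x≤c*[n∸w]⇒p*[x+w]≤c*n p 19 (2 ^ e) (W t) w p≤19 (<⇒≤ w<2^e)
    (2^p≤d^q∧d^[q*x]≤2^c⇒p*x≤c p 10 d (W t) _ 2^p≤d^10 d^[10*Wt]≤2^[19*[2^e∸w]])

  large : 2 ^ 19 ≤ d ^ 10 → W t + w ≤ 2 ^ e
  large 2^19≤d^10 = *-cancelˡ-≤ 19 (budget 19 ≤-refl 2^19≤d^10)

  small : ¬ (2 ^ 19 ≤ d ^ 10) → d ^ (1 * (W t + w)) ≤ 2 ^ (2 ^ d)
  small ¬2^19≤d^10 = ≤-trans (≤-reflexive (cong (d ^_) (*-identityˡ (W t + w))))
    (small-base-bound d (W t + w) 1<d (¬2^19≤d^10⇒d≤3 d ¬2^19≤d^10) budget)
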